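{- In the setting described in the context, for every $u\in V$ and every function $f\colon\mathsf{tail}(u)\to\{0,1_L,1_R,2_L,2_R\}$, $$P(u,f)=P[u,f[u\mapsto 2_L]]+P[u,f[u\mapsto 2_R]]-2\,P[u,f[u\mapsto 1_L]]-2\,P[u,f[u\mapsto 1_R]]+P[u,f[u\mapsto 0]].$$
   Context: $G=(V,E)$ is a connected undirected graph, $\omega\colon E\to\{1,\ldots,N\}$, and $T$ is an elimination tree of $G$ (a rooted tree on $V$ such that for every edge $uv$ one endpoint is an ancestor of the other; ancestors/descendants are reflexive). For $u\in V$: $\mathsf{tail}[u]$ = ancestors of $u$, $\mathsf{tail}(u)=\mathsf{tail}[u]\setminus\{u\}$, $\mathsf{subtree}[u]$ = descendants of $u$, $\mathsf{subtree}(u)=\mathsf{subtree}[u]\setminus\{u\}$. $G'$ has vertex set $V'=\{u^0,u^1:u\in V\}$ and edges $E'=E'_0\cup E'_1$, $E'_0=\{u^0u^1:u\in V\}$, $E'_1=\{u^sv^t: uv\in E, s,t\in\{0,1\}\}$; $\pi(u^sv^t)=uv$; $F\subseteq E'$ is simple if $|F\cap\pi^{ -1}(e)|\le1$ for all $e\in E$; $\omega$ extends to $E'$ by $0$ on $E'_0$ and $\omega(\pi(e))$ on $E'_1$, $\omega(F)=\sum_{e\in F}\omega(e)$. For $Z\subseteq V$, $Z'=\{z^0,z^1:z\in Z\}$. Fix an ordering of the children of each vertex of $T$; $\mathsf{left}(u)$ is the leaf reached from $u$ by repeatedly moving to the first child. For $e=u^0u^1$ set $\overline{\mathsf{left}}(e)=\mathsf{left}(u)$;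 for $e=u^sv^t\in E'_1$ with $v$ a descendant of $u$ set $\overline{\mathsf{left}}(e)=\mathsf{left}(v)$. $\mathsf{sheaf}[u]=\{e\in E':\overline{\mathsf{left}}(e)\text{ is a leaf in }\mathsf{subtree}[u]\}$. For disjoint $X,Y\subseteq V$, $S\subseteq E'$ with endpoints in $X'\cup Y'$, and $f\colon Y\to\{0,1_L,1_R,2_L,2_R\}$, a pair $(F,(L,R))$ with $F\subseteq S$ and $(L,R)$ an ordered partition of $X\cup Y$ is compatible with $f$ if: $F$ is simple and no edge of $F$ joins $L'$ and $R'$; $f^{ -1}(\{1_L,2_L\})\subseteq L$, $f^{ -1}(\{1_R,2_R\})\subseteq R$; if $f(y)=0$ no edge of $F$ is incident to $y^0$ or $y^1$; if $f(y)\in\{1_L,1_R\}$ no edge of $F$ is incident to $y^1$; every vertex of $X'$ is incident to some edge of $F$. For $f\colon\mathsf{tail}[u]\to\{0,1_L,1_R,2_L,2_R\}$, $\mathcal{M}[u,f]$ is the set of pairs compatible with $f$ for $X=\mathsf{subtree}(u)$, $Y=\mathsf{tail}[u]$, $S=\mathsf{sheaf}[u]$; for $f\colon\mathsf{tail}(u)\to\{0,1_L,1_R,2_L,2_R\}$, $\mathcal{M}(u,f)$ is the analogous set for $X=\mathsf{subtree}[u]$, $Y=\mathsf{tail}(u)$, $S=\mathsf{sheaf}[u]$. $P[u,f]=\sum_{(F,(L,R))\in\mathcal{M}[u,f]}\alpha^{\omega(F)}\beta^{|F|}\gamma^{|F\cap E'_1|}\in\mathbb{Z}[\alpha,\beta,\gamma]$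 and $P(u,f)$ is defined likewise from $\mathcal{M}(u,f)$. $f[u\mapsto s]$ denotes the extension of $f$ to $\mathsf{tail}[u]$ with $u\mapsto s$. -}

module Defs where

open import Data.Bool using (Bool; true; false; _∧_; _∨_; not; if_then_else_)
open import Data.Nat using (ℕ; zero; suc; _≤_; _≤ᵇ_; _+_)
open import Data.Fin using (Fin; _<_)
open import Data.Fin.Properties using (_≟_; _<?_)
open import Data.List using (List; []; _∷_; _++_; map; filterᵇ; length; concatMap)
open import Data.Bool.ListAction using (all; any)
open import Data.Nat.ListAction using (sum)
open import Data.List.Membership.Propositional using (_∈_)
open import Data.Maybe using (Maybe; just; nothing)
open import Data.Product using (Σ; _×_; _,_)
open import Data.Sum using (_⊎_)
open import Data.Empty using (⊥)
open import Relation.Nullary using (does; ¬_)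
open import Relation.Binary.PropositionalEquality using (_≡_; _≢_)
open import Data.Integer as ℤ using (ℤ; +_)

data Label : Set where
  l0 l1L l1R l2L l2R : Label

-- all sublists (= all subsets, when the list is duplicate-free)
subsets : {A : Set} → List A → List (List A)
subsets []       = [] ∷ []
subsets (x ∷ xs) = map (x ∷_) (subsets xs) ++ subsets xs

allFin : (n : ℕ) → List (Fin n)
allFin zero    = []
allFin (suc n) = Fin.zero ∷ map Fin.suc (allFin n)
  where import Data.Fin as Fin

module _ {n : ℕ} where
  _==_ : Fin n → Fin n → Bool
  x == y = does (x ≟ y)

  _∈ᵇ_ : Fin n → List (Fin n) → Bool
  x ∈ᵇ xs = any (x ==_) xs

data Reach {n : ℕ} (Adj : Fin n → Fin n → Bool) (u : Fin n) : Fin n → Set where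
  here : Reach Adj u u
  step : ∀ {v w} → Reach Adj u v → Adj v w ≡ true → Reach Adj u w

chain : {n : ℕ} → (Fin n → Maybe (Fin n)) → ℕ → Fin n → List (Fin n)
chain par zero    v = []
chain par (suc k) v with par v
... | nothing = v ∷ []
... | just p  = v ∷ chain par k p

descendFirst : {n : ℕ} → (Fin n → Maybe (Fin n)) → ℕ → Fin n → Fin n
descendFirst fc zero    v = v
descendFirst fc (suc k) v with fc v
... | nothing = v
... | just c  = descendFirst fc k c

-- The setting: weighted connected graph G with an elimination tree T
-- (given by parent pointers) and a fixed ordering of the children
-- (only its first child matters, given by `firstChild`).

record Setting (n : ℕ) : Set where
  field
    Adj       : Fin n → Fin n → Bool
    Adj-sym   : ∀ u v → Adj u v ≡ Adj v u
    Adj-irr   : ∀ u → Adj u u ≡ false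
    connected : ∀ u v → Reach Adj u v
    N         : ℕ
    -- weight of the edge {u,v} is ω u v (only used for u < v, Adj u v)
    ω         : Fin n → Fin n → ℕ
    ω-range   : ∀ u v → u < v → Adj u v ≡ true → 1 ≤ ω u v × ω u v ≤ N
    parent    : Fin n → Maybe (Fin n)
    root      : Fin n
    root-par  : parent root ≡ nothing
    to-root   : ∀ v → root ∈ chain parent n v
    firstChild        : Fin n → Maybe (Fin n)
    firstChild-child  : ∀ u c → firstChild u ≡ just c → parent c ≡ just u
    firstChild-none   : ∀ u → firstChild u ≡ nothing → ∀ c → parent c ≢ just u

  -- reflexive ancestor relation in T:  isAnc a v  iff  a ∈ tail[v]
  isAnc : Fin n → Fin n → Bool
  isAnc a v = a ∈ᵇ chain parent n v

  field
    elim : ∀ u v → Adj u v ≡ true → isAnc u v ≡ true ⊎ isAnc v u ≡ true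

module Construction {n : ℕ} (G : Setting n) where
  open Setting G

  V : List (Fin n)
  V = allFin n

  tail[_] tail⟨_⟩ subtree[_] subtree⟨_⟩ : Fin n → List (Fin n)
  tail[ u ]    = filterᵇ (λ a → isAnc a u) V
  tail⟨ u ⟩    = filterᵇ (λ a → isAnc a u ∧ not (a == u)) V
  subtree[ u ] = filterᵇ (λ d → isAnc u d) V
  subtree⟨ u ⟩ = filterᵇ (λ d → isAnc u d ∧ not (d == u)) V

  left : Fin n → Fin n
  left = descendFirst firstChild n

  -- edges of G'.  A copy index s : Bool (false = 0, true = 1).
  --   e0 u          is  u^0 u^1            (in E'_0)
  --   e1 u v s t    is  u^s v^t, u < v     (in E'_1, π = uv)
  data Edge' : Set where
    e0 : Fin n → Edge'
    e1 : Fin n → Fin n → Bool → Bool → Edge'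

  bools : List Bool
  bools = false ∷ true ∷ []

  E'₀ E'₁ E' : List Edge'
  E'₀ = map e0 V
  E'₁ = concatMap (λ u → concatMap (λ v →
          if does (u <? v) ∧ Adj u v
          then concatMap (λ s → map (e1 u v s) bools) bools
          else []) V) V
  E' = E'₀ ++ E'₁

  isE1 : Edge' → Bool
  isE1 (e0 _)       = false
  isE1 (e1 _ _ _ _) = true

  ω' : Edge' → ℕ
  ω' (e0 _)       = 0
  ω' (e1 u v _ _) = ω u v

  ωF : List Edge' → ℕ
  ωF F = sum (map ω' F)

  samePi : Edge' → Edge' → Bool
  samePi (e1 u v _ _) (e1 u' v' _ _) = (u == u') ∧ (v == v')
  samePi _ _ = false

  incident : Edge' → Fin n → Bool → Bool
  incident (e0 u)       x s = u == x
  incident (e1 u v a b) x s = ((u == x) ∧ (a ⇔ s)) ∨ ((v == x) ∧ (b ⇔ s))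
    where
      _⇔_ : Bool → Bool → Bool
      true  ⇔ true  = true
      false ⇔ false = true
      _     ⇔ _     = false

  leftBar : Edge' → Fin n
  leftBar (e0 u)       = left u
  leftBar (e1 u v _ _) = if isAnc u v then left v else left u

  sheaf : Fin n → List Edge'
  sheaf u = filterᵇ (λ e → isAnc u (leftBar e)) E'

  isL isR : Label → Bool
  isL l1L = true
  isL l2L = true
  isL _   = false
  isR l1R = true
  isR l2R = true
  isR _   = false

  is0 is1 : Label → Bool
  is0 l0 = true
  is0 _  = false
  is1 l1L = true
  is1 l1R = true
  is1 _   = false

  _⇒_ : Bool → Bool → Bool
  a ⇒ b = not a ∨ b

  compatible : (X Y : List (Fin n)) → (Fin n → Label) → List Edge' → List (Fin n) → Bool
  compatible X Y f F L =
      all (λ e → length (filterᵇ (samePi e) F) ≤ᵇ 1) F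
    ∧ all (λ e → not (joinsLR e)) F
    ∧ all (λ y → (isL (f y) ⇒ inL y) ∧ (isR (f y) ⇒ inR y)) Y
    ∧ all (λ y → is0 (f y) ⇒ not (any (λ e → incident e y false ∨ incident e y true) F)) Y
    ∧ all (λ y → is1 (f y) ⇒ not (any (λ e → incident e y true) F)) Y
    ∧ all (λ x → any (λ e → incident e x false) F ∧ any (λ e → incident e x true) F) X
    where
      R : List (Fin n)
      R = filterᵇ (λ v → not (v ∈ᵇ L)) (X ++ Y)
      inL inR : Fin n → Bool
      inL v = v ∈ᵇ L
      inR v = v ∈ᵇ R
      joinsLR : Edge' → Bool
      joinsLR (e0 _)       = false
      joinsLR (e1 a b _ _) = (inL a ∧ inR b) ∨ (inR a ∧ inL b)

  -- a monomial α^a β^b γ^c is recorded as (a , b , c)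
  Monomial : Set
  Monomial = ℕ × ℕ × ℕ

  -- a polynomial in ℤ[α,β,γ] with nonnegative coefficients, as a
  -- multiset (list) of monomials; its coefficients are multiplicities
  Poly : Set
  Poly = List Monomial

  _==ᵐ_ : Monomial → Monomial → Bool
  (a , b , c) ==ᵐ (a' , b' , c') = does (a Data.Nat.≟ a') ∧ does (b Data.Nat.≟ b') ∧ does (c Data.Nat.≟ c')
    where import Data.Nat

  coeff : Poly → Monomial → ℤ
  coeff p m = + length (filterᵇ (_==ᵐ m) p)

  M : (X Y : List (Fin n)) → List Edge' → (Fin n → Label) → List (List Edge' × List (Fin n))
  M X Y S f = filterᵇ (λ { (F , L) → compatible X Y f F L })
                (concatMap (λ F → map (F ,_) (subsets (X ++ Y))) (subsets S))

  poly : List (List Edge' × List (Fin n)) → Poly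
  poly = map (λ { (F , L) → (ωF F , length F , length (filterᵇ isE1 F)) })

  -- P[u,f], f considered on tail[u]
  P[_,_] : Fin n → (Fin n → Label) → Poly
  P[ u , f ] = poly (M subtree⟨ u ⟩ tail[ u ] (sheaf u) f)

  -- P(u,f), f considered on tail(u)
  P⟨_,_⟩ : Fin n → (Fin n → Label) → Poly
  P⟨ u , f ⟩ = poly (M subtree[ u ] tail⟨ u ⟩ (sheaf u) f)

  _[_↦_] : (Fin n → Label) → Fin n → Label → (Fin n → Label)
  (f [ u ↦ s ]) x = if x == u then s else f x

module Submission where

-- We compare coefficients of a fixed monomial m.  The coefficient of m in P(u,f) or in
-- P[u,f[u ↦ l]] counts candidate pairs (F ⊆ sheaf[u], L), and after reordering the
-- vertex lists (subtree[u] = u ∷ subtree(u), tail[u] = u ∷ tail(u)) both range over the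
-- same candidates.  Every compatibility test then splits as  common F L ∧ (condition on u):
-- for P(u,f) u must be covered (both copies u⁰, u¹ touched), for P[u,f[u ↦ l]] u must
-- satisfy label l.  At a single candidate the five label conditions satisfy a Boolean
-- inclusion–exclusion identity (local-count), which leaves two correction terms: the
-- candidates missing u⁰ and those missing u¹.  These are equinumerous because exchanging
-- u⁰ and u¹ in every edge (flipU) permutes the sheaf and preserves everything except which
-- copy of u is touched (missing-symmetry).  Summing gives an identity of natural numbers,
-- which is rearranged in ℤ.

open import Defs

module Proof where
  open import Data.Bool using (Bool; true; false; _∧_; _∨_; not; _xor_; if_then_else_; T?)
  open import Data.Bool.Properties
    using (∧-comm; ∧-zeroʳ; ∧-identityʳ; ∧-commutativeMonoid; ∧-isCommutativeMonoid; ∨-isCommutativeMonoid)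
  open import Data.Bool.ListAction using (and; or; all; any)
  open import Data.Nat using (ℕ; suc; _+_; _≤ᵇ_)
  open import Data.Nat.Properties using (+-cancelʳ-≡; +-commutativeSemigroup)
  open import Data.Nat.ListAction using (sum)
  open import Data.Nat.ListAction.Properties using (sum-++; sum-↭)
  open import Data.Fin using (Fin)
  import Data.Fin as Fin
  open import Data.Fin.Properties using (_≟_; _<?_)
  open import Data.List using (List; []; _∷_; _++_; map; filterᵇ; length; concatMap)
  open import Data.List.Properties using (map-cong; map-∘; map-++; length-map)
  open import Data.List.Relation.Binary.Permutation.Propositional
    using (_↭_; ↭-refl; ↭-sym; ↭-trans; ↭-reflexive; ↭⇒↭ₛ; module PermutationReasoning)
  open import Data.List.Relation.Binary.Permutation.Propositional.Properties
    using (map⁺; ++⁺; ++⁺ˡ; ++⁺ʳ; ++-comm; shift; filter-↭; ↭-length)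
  open import Data.List.Relation.Binary.Permutation.Setoid.Properties using (foldr-commMonoid)
  open import Data.Maybe using (Maybe; just; nothing)
  open import Data.Product using (_×_; _,_)
  import Data.Integer as ℤ
  open import Function using (_∘_)
  open import Relation.Nullary using (yes; no; does)
  open import Relation.Nullary.Decidable using (dec-true)
  open import Relation.Binary.PropositionalEquality
    using (_≡_; refl; sym; trans; cong; cong₂; setoid; module ≡-Reasoning)
  open import Algebra.Properties.CommutativeSemigroup +-commutativeSemigroup using (interchange)
  import Algebra.Solver.CommutativeMonoid ∧-commutativeMonoid as ∧-Solver
  import Data.List.Relation.Binary.Permutation.Propositional as Perm

  𝟙 : Bool → ℕ
  𝟙 true  = 1
  𝟙 false = 0

  and-↭ : {bs cs : List Bool} → bs ↭ cs → and bs ≡ and cs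
  and-↭ p = foldr-commMonoid (setoid Bool) ∧-isCommutativeMonoid (↭⇒↭ₛ p)

  or-↭ : {bs cs : List Bool} → bs ↭ cs → or bs ≡ or cs
  or-↭ p = foldr-commMonoid (setoid Bool) ∨-isCommutativeMonoid (↭⇒↭ₛ p)

  module _ {A : Set} where

    all-↭ : (p : A → Bool) {xs ys : List A} → xs ↭ ys → all p xs ≡ all p ys
    all-↭ p q = and-↭ (map⁺ p q)

    any-↭ : (p : A → Bool) {xs ys : List A} → xs ↭ ys → any p xs ≡ any p ys
    any-↭ p q = or-↭ (map⁺ p q)

    all-cong : {p q : A → Bool} (xs : List A) → (∀ x → p x ≡ q x) → all p xs ≡ all q xs
    all-cong xs e = cong and (map-cong e xs)

    any-cong : {p q : A → Bool} (xs : List A) → (∀ x → p x ≡ q x) → any p xs ≡ any q xs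
    any-cong xs e = cong or (map-cong e xs)

    all-∧ : (p q : A → Bool) (xs : List A) → all (λ x → p x ∧ q x) xs ≡ all p xs ∧ all q xs
    all-∧ p q []       = refl
    all-∧ p q (x ∷ xs) rewrite all-∧ p q xs = ∧-Solver.solve 4
      (λ a b c d → (a ⊕ b) ⊕ (c ⊕ d) ⊜ (a ⊕ c) ⊕ (b ⊕ d)) refl (p x) (q x) (all p xs) (all q xs)
      where open ∧-Solver

    any-∨ : (p q : A → Bool) (xs : List A) → any (λ x → p x ∨ q x) xs ≡ any p xs ∨ any q xs
    any-∨ p q []       = refl
    any-∨ p q (x ∷ xs) rewrite any-∨ p q xs = ∨-interchange (p x) (q x) (any p xs) (any q xs)
      where
      ∨-interchange : ∀ a b c d → (a ∨ b) ∨ (c ∨ d) ≡ (a ∨ c) ∨ (b ∨ d)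
      ∨-interchange true  b     c     d = refl
      ∨-interchange false true  true  d = refl
      ∨-interchange false true  false d = refl
      ∨-interchange false false c     d = refl

    all-map : {B : Set} (p : B → Bool) (g : A → B) (xs : List A) → all p (map g xs) ≡ all (p ∘ g) xs
    all-map p g xs = cong and (sym (map-∘ xs))

    any-map : {B : Set} (p : B → Bool) (g : A → B) (xs : List A) → any p (map g xs) ≡ any (p ∘ g) xs
    any-map p g xs = cong or (sym (map-∘ xs))

    all-filterᵇ-cong : {p p' : A → Bool} (c : A → Bool) (xs : List A) →
      (∀ x → c x ≡ true → p x ≡ p' x) → all p (filterᵇ c xs) ≡ all p' (filterᵇ c xs)
    all-filterᵇ-cong c []       e = refl
    all-filterᵇ-cong c (x ∷ xs) e with c x in cx
    ... | true  = cong₂ _∧_ (e x cx) (all-filterᵇ-cong c xs e)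
    ... | false = all-filterᵇ-cong c xs e

    filterᵇ-cong : {p q : A → Bool} (xs : List A) → (∀ x → p x ≡ q x) → filterᵇ p xs ≡ filterᵇ q xs
    filterᵇ-cong []             e = refl
    filterᵇ-cong {p} {q} (x ∷ xs) e rewrite e x with q x
    ... | true  = cong (x ∷_) (filterᵇ-cong xs e)
    ... | false = filterᵇ-cong xs e

    filterᵇ-split : (c q : A → Bool) (xs : List A) →
      filterᵇ c xs ↭ filterᵇ (λ x → c x ∧ not (q x)) xs ++ filterᵇ (λ x → c x ∧ q x) xs
    filterᵇ-split c q []       = ↭-refl
    filterᵇ-split c q (x ∷ xs) with c x
    ... | false = filterᵇ-split c q xs
    ... | true with q x
    ...   | false = Perm.prep x (filterᵇ-split c q xs)
    ...   | true  = ↭-trans (Perm.prep x (filterᵇ-split c q xs)) (↭-sym (shift x _ _))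

    map-filterᵇ : (g : A → A) (p : A → Bool) → (∀ x → p (g x) ≡ p x) → (xs : List A) →
      map g (filterᵇ p xs) ≡ filterᵇ p (map g xs)
    map-filterᵇ g p e []       = refl
    map-filterᵇ g p e (x ∷ xs) rewrite e x with p x
    ... | true  = cong (g x ∷_) (map-filterᵇ g p e xs)
    ... | false = map-filterᵇ g p e xs

    map-concatMap-↭ : {B : Set} (g : B → B) (k : A → List B) (xs : List A) →
      (∀ x → map g (k x) ↭ k x) → map g (concatMap k xs) ↭ concatMap k xs
    map-concatMap-↭ g k []       h = ↭-refl
    map-concatMap-↭ g k (x ∷ xs) h =
      ↭-trans (↭-reflexive (map-++ g (k x) (concatMap k xs))) (++⁺ (h x) (map-concatMap-↭ g k xs h))

  sumOver : {A : Set} → List A → (A → ℕ) → ℕ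
  sumOver xs w = sum (map w xs)

  syntax sumOver xs (λ x → w) = ∑[ x ∈ xs ] w

  module _ {A : Set} where

    ∑-cong : (xs : List A) {w w' : A → ℕ} → (∀ x → w x ≡ w' x) → sumOver xs w ≡ sumOver xs w'
    ∑-cong xs e = cong sum (map-cong e xs)

    ∑-+ : (xs : List A) (w w' : A → ℕ) → ∑[ x ∈ xs ] (w x + w' x) ≡ sumOver xs w + sumOver xs w'
    ∑-+ []       w w' = refl
    ∑-+ (x ∷ xs) w w' rewrite ∑-+ xs w w' = interchange (w x) (w' x) (sumOver xs w) (sumOver xs w')

    ∑-++ : (xs ys : List A) (w : A → ℕ) → sumOver (xs ++ ys) w ≡ sumOver xs w + sumOver ys w
    ∑-++ xs ys w = trans (cong sum (map-++ w xs ys)) (sum-++ (map w xs) (map w ys))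

    ∑-↭ : {xs ys : List A} (w : A → ℕ) → xs ↭ ys → sumOver xs w ≡ sumOver ys w
    ∑-↭ w p = sum-↭ (map⁺ w p)

    length-filterᵇ : (p : A → Bool) (xs : List A) → length (filterᵇ p xs) ≡ ∑[ x ∈ xs ] 𝟙 (p x)
    length-filterᵇ p []       = refl
    length-filterᵇ p (x ∷ xs) with p x
    ... | true  = cong suc (length-filterᵇ p xs)
    ... | false = length-filterᵇ p xs

    ∑-filterᵇ : (c p : A → Bool) (xs : List A) → ∑[ x ∈ filterᵇ c xs ] 𝟙 (p x) ≡ ∑[ x ∈ xs ] 𝟙 (c x ∧ p x)
    ∑-filterᵇ c p []       = refl
    ∑-filterᵇ c p (x ∷ xs) with c x
    ... | true  = cong (𝟙 (p x) +_) (∑-filterᵇ c p xs)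
    ... | false = ∑-filterᵇ c p xs

  module _ {A B : Set} where

    ∑-map : (g : A → B) (xs : List A) (w : B → ℕ) → sumOver (map g xs) w ≡ sumOver xs (w ∘ g)
    ∑-map g xs w = cong sum (sym (map-∘ xs))

    ∑-concatMap : (k : A → List B) (xs : List A) (w : B → ℕ) →
      sumOver (concatMap k xs) w ≡ ∑[ x ∈ xs ] sumOver (k x) w
    ∑-concatMap k []       w = refl
    ∑-concatMap k (x ∷ xs) w = trans (∑-++ (k x) (concatMap k xs) w) (cong (sumOver (k x) w +_) (∑-concatMap k xs w))

    length-filterᵇ-map : (p : B → Bool) (g : A → B) (xs : List A) →
      length (filterᵇ p (map g xs)) ≡ length (filterᵇ (p ∘ g) xs)
    length-filterᵇ-map p g xs = begin
        length (filterᵇ p (map g xs))   ≡⟨ length-filterᵇ p (map g xs) ⟩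
        ∑[ y ∈ map g xs ] 𝟙 (p y)       ≡⟨ ∑-map g xs (𝟙 ∘ p) ⟩
        ∑[ x ∈ xs ] 𝟙 (p (g x))         ≡⟨ sym (length-filterᵇ (p ∘ g) xs) ⟩
        length (filterᵇ (p ∘ g) xs)     ∎
      where open ≡-Reasoning

    subsets-map : (g : A → B) (xs : List A) → subsets (map g xs) ≡ map (map g) (subsets xs)
    subsets-map g []       = refl
    subsets-map g (x ∷ xs) = begin
        map (g x ∷_) (subsets (map g xs)) ++ subsets (map g xs)
      ≡⟨ cong (λ s → map (g x ∷_) s ++ s) (subsets-map g xs) ⟩
        map (g x ∷_) (map (map g) (subsets xs)) ++ map (map g) (subsets xs)
      -- both orders of prefixing and mapping map by the same composite
      ≡⟨ cong (_++ map (map g) (subsets xs)) (trans (sym (map-∘ (subsets xs))) (map-∘ (subsets xs))) ⟩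
        map (map g) (map (x ∷_) (subsets xs)) ++ map (map g) (subsets xs)
      ≡⟨ sym (map-++ (map g) (map (x ∷_) (subsets xs)) (subsets xs)) ⟩
        map (map g) (map (x ∷_) (subsets xs) ++ subsets xs)
      ∎
      where open ≡-Reasoning

  module _ {A : Set} where

    Respects↭ : (List A → ℕ) → Set
    Respects↭ w = ∀ {as bs} → as ↭ bs → w as ≡ w bs

    ∑-subsets-∷ : (x : A) (xs : List A) (w : List A → ℕ) →
      sumOver (subsets (x ∷ xs)) w ≡ ∑[ a ∈ subsets xs ] w (x ∷ a) + sumOver (subsets xs) w
    ∑-subsets-∷ x xs w = trans (∑-++ (map (x ∷_) (subsets xs)) (subsets xs) w)
                               (cong (_+ sumOver (subsets xs) w) (∑-map (x ∷_) (subsets xs) w))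

    ∑-subsets-↭ : {xs ys : List A} → xs ↭ ys → (w : List A → ℕ) → Respects↭ w →
      sumOver (subsets xs) w ≡ sumOver (subsets ys) w
    ∑-subsets-↭ (Perm.refl) w r = refl
    ∑-subsets-↭ (Perm.prep {xs} {ys} x p) w r = begin
        sumOver (subsets (x ∷ xs)) w
      ≡⟨ ∑-subsets-∷ x xs w ⟩
        ∑[ a ∈ subsets xs ] w (x ∷ a) + sumOver (subsets xs) w
      ≡⟨ cong₂ _+_ (∑-subsets-↭ p (w ∘ (x ∷_)) (r ∘ Perm.prep x)) (∑-subsets-↭ p w r) ⟩
        ∑[ a ∈ subsets ys ] w (x ∷ a) + sumOver (subsets ys) w
      ≡⟨ sym (∑-subsets-∷ x ys w) ⟩
        sumOver (subsets (x ∷ ys)) w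
      ∎
      where open ≡-Reasoning
    ∑-subsets-↭ (Perm.swap {xs} {ys} x y p) w r = begin
        sumOver (subsets (x ∷ y ∷ xs)) w
      ≡⟨ two-steps x y xs ⟩
        (∑⟨ xs ⟩ (x ∷ y ∷ []) + ∑⟨ xs ⟩ (x ∷ [])) + (∑⟨ xs ⟩ (y ∷ []) + sumOver (subsets xs) w)
      ≡⟨ cong₂ _+_ (cong₂ _+_ (trans (same (x ∷ y ∷ [])) (∑-cong (subsets ys) (λ a → r (Perm.swap x y ↭-refl))))
                              (same (x ∷ [])))
                   (cong₂ _+_ (same (y ∷ [])) (∑-subsets-↭ p w r)) ⟩
        (∑⟨ ys ⟩ (y ∷ x ∷ []) + ∑⟨ ys ⟩ (x ∷ [])) + (∑⟨ ys ⟩ (y ∷ []) + sumOver (subsets ys) w)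
      ≡⟨ interchange (∑⟨ ys ⟩ (y ∷ x ∷ [])) _ _ _ ⟩
        (∑⟨ ys ⟩ (y ∷ x ∷ []) + ∑⟨ ys ⟩ (y ∷ [])) + (∑⟨ ys ⟩ (x ∷ []) + sumOver (subsets ys) w)
      ≡⟨ sym (two-steps y x ys) ⟩
        sumOver (subsets (y ∷ x ∷ ys)) w
      ∎
      where
      open ≡-Reasoning
      ∑⟨_⟩ : List A → List A → ℕ
      ∑⟨ zs ⟩ pre = ∑[ a ∈ subsets zs ] w (pre ++ a)
      two-steps : ∀ a b zs → sumOver (subsets (a ∷ b ∷ zs)) w
        ≡ (∑⟨ zs ⟩ (a ∷ b ∷ []) + ∑⟨ zs ⟩ (a ∷ [])) + (∑⟨ zs ⟩ (b ∷ []) + sumOver (subsets zs) w)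
      two-steps a b zs = trans (∑-subsets-∷ a (b ∷ zs) w)
        (cong₂ _+_ (∑-subsets-∷ b zs (λ c → w (a ∷ c))) (∑-subsets-∷ b zs w))
      same : ∀ pre → ∑⟨ xs ⟩ pre ≡ ∑⟨ ys ⟩ pre
      same pre = ∑-subsets-↭ p (λ a → w (pre ++ a)) (r ∘ ++⁺ˡ pre)
    ∑-subsets-↭ (Perm.trans p q) w r = trans (∑-subsets-↭ p w r) (∑-subsets-↭ q w r)

  module _ {n : ℕ} where

    ==-refl : (x : Fin n) → x == x ≡ true
    ==-refl x = dec-true (x ≟ x) refl

    -- x == y is  does (x ≟ y); it is written unfolded so that the case split on x ≟ y applies
    ==⇒≡ : {x y : Fin n} → does (x ≟ y) ≡ true → x ≡ y
    ==⇒≡ {x} {y} e with x ≟ y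
    ... | yes x≡y = x≡y
    ==⇒≡ () | no _

    ∈ᵇ-filterᵇ : (q : Fin n → Bool) (v : Fin n) (xs : List (Fin n)) → v ∈ᵇ filterᵇ q xs ≡ q v ∧ v ∈ᵇ xs
    ∈ᵇ-filterᵇ q v []       = sym (∧-zeroʳ (q v))
    ∈ᵇ-filterᵇ q v (x ∷ xs) with q x in qx
    ... | true  = trans (cong ((v == x) ∨_) (∈ᵇ-filterᵇ q v xs)) (kept (v == x) (q v) _ (λ e → trans (cong q (==⇒≡ e)) qx))
      where
      kept : ∀ a b c → (a ≡ true → b ≡ true) → a ∨ (b ∧ c) ≡ b ∧ (a ∨ c)
      kept true  b c h rewrite h refl = refl
      kept false b c h = refl
    ... | false = trans (∈ᵇ-filterᵇ q v xs) (dropped (v == x) (q v) _ (λ e → trans (cong q (==⇒≡ e)) qx))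
      where
      dropped : ∀ a b c → (a ≡ true → b ≡ false) → b ∧ c ≡ b ∧ (a ∨ c)
      dropped true  b c h rewrite h refl = refl
      dropped false b c h = refl

  allFin-unique : {n : ℕ} (u : Fin n) → filterᵇ (_== u) (allFin n) ≡ u ∷ []
  allFin-unique {suc n} Fin.zero    = cong (Fin.zero ∷_) (no-zero (allFin n))
    where
    no-zero : (xs : List (Fin n)) → filterᵇ (_== Fin.zero) (map Fin.suc xs) ≡ []
    no-zero []       = refl
    no-zero (x ∷ xs) = no-zero xs
  allFin-unique {suc n} (Fin.suc u) = trans (sym (map-filterᵇ-suc (allFin n))) (cong (map Fin.suc) (allFin-unique u))
    where
    map-filterᵇ-suc : (xs : List (Fin n)) → map Fin.suc (filterᵇ (_== u) xs) ≡ filterᵇ (_== Fin.suc u) (map Fin.suc xs)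
    map-filterᵇ-suc []       = refl
    map-filterᵇ-suc (x ∷ xs) with x == u
    ... | true  = cong (Fin.suc x ∷_) (map-filterᵇ-suc xs)
    ... | false = map-filterᵇ-suc xs

  extract : {n : ℕ} (c : Fin n → Bool) (u : Fin n) → c u ≡ true →
    filterᵇ c (allFin n) ↭ u ∷ filterᵇ (λ v → c v ∧ not (v == u)) (allFin n)
  extract {n} c u cu = begin
      filterᵇ c (allFin n)
    ↭⟨ filterᵇ-split c (_== u) (allFin n) ⟩
      rest ++ filterᵇ (λ v → c v ∧ v == u) (allFin n)
    ≡⟨ cong (rest ++_) (trans (filterᵇ-cong (allFin n) only-u) (allFin-unique u)) ⟩
      rest ++ u ∷ []
    ↭⟨ ++-comm rest (u ∷ []) ⟩
      u ∷ rest
    ∎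
    where
    open PermutationReasoning
    rest : List (Fin n)
    rest = filterᵇ (λ v → c v ∧ not (v == u)) (allFin n)
    only-u : ∀ v → c v ∧ v == u ≡ v == u
    only-u v with v ≟ u
    ... | yes refl = cong (_∧ true) cu
    ... | no  _    = ∧-zeroʳ (c v)

  chain-starts : {n : ℕ} (par : Fin n → Maybe (Fin n)) (v : Fin n) → v ∈ᵇ chain par n v ≡ true
  chain-starts {suc n} par v with par v
  ... | nothing = cong (_∨ false) (==-refl v)
  ... | just p  = cong (_∨ (v ∈ᵇ chain par n p)) (==-refl v)

  module _ where
    open ∧-Solver

    regroup : ∀ a b c d e g → a ∧ b ∧ c ∧ d ∧ e ∧ g ≡ (a ∧ b) ∧ (c ∧ d ∧ e) ∧ g
    regroup = solve 6 (λ a b c d e g → a ⊕ b ⊕ c ⊕ d ⊕ e ⊕ g ⊜ (a ⊕ b) ⊕ (c ⊕ d ⊕ e) ⊕ g) refl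

    pull-out-last : ∀ e a k c μ → (e ∧ a ∧ (k ∧ c)) ∧ μ ≡ ((e ∧ a ∧ c) ∧ μ) ∧ k
    pull-out-last = solve 5 (λ e a k c μ → (e ⊕ a ⊕ (k ⊕ c)) ⊕ μ ⊜ ((e ⊕ a ⊕ c) ⊕ μ) ⊕ k) refl

    pull-out-middle : ∀ e k a c μ → (e ∧ (k ∧ a) ∧ c) ∧ μ ≡ ((e ∧ a ∧ c) ∧ μ) ∧ k
    pull-out-middle = solve 5 (λ e k a c μ → (e ⊕ (k ⊕ a) ⊕ c) ⊕ μ ⊜ ((e ⊕ a ⊕ c) ⊕ μ) ⊕ k) refl

  module Decomposition {n : ℕ} (G : Setting n) where
    open Setting G
    open Construction G

    touches : List Edge' → Fin n → Bool → Bool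
    touches F y s = any (λ e → incident e y s) F

    covered : List Edge' → Fin n → Bool
    covered F x = touches F x false ∧ touches F x true

    admits : Label → (inL inR t₀ t₁ : Bool) → Bool
    admits l inL inR t₀ t₁ = ((isL l ⇒ inL) ∧ (isR l ⇒ inR)) ∧ (is0 l ⇒ not (t₀ ∨ t₁)) ∧ (is1 l ⇒ not t₁)

    labelled : (Fin n → Label) → List Edge' → (inL inR : Fin n → Bool) → Fin n → Bool
    labelled f F inL inR y = admits (f y) (inL y) (inR y) (touches F y false) (touches F y true)

    crosses : (inL inR : Fin n → Bool) → Edge' → Bool
    crosses inL inR (e0 _)       = false
    crosses inL inR (e1 a b _ _) = (inL a ∧ inR b) ∨ (inR a ∧ inL b)

    simple : List Edge' → Bool
    simple F = all (λ e → length (filterᵇ (samePi e) F) ≤ᵇ 1) F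

    compat : (X Y : List (Fin n)) → (Fin n → Label) → List Edge' → (inL inR : Fin n → Bool) → Bool
    compat X Y f F inL inR =
      (simple F ∧ all (not ∘ crosses inL inR) F) ∧ all (labelled f F inL inR) Y ∧ all (covered F) X

    compat-sides : ∀ X Y f F {inL inL' inR inR' : Fin n → Bool} →
      (∀ v → inL v ≡ inL' v) → (∀ v → inR v ≡ inR' v) → compat X Y f F inL inR ≡ compat X Y f F inL' inR'
    compat-sides X Y f F {inL} {inL'} {inR} {inR'} eL eR =
      cong₂ (λ a b → (simple F ∧ a) ∧ b ∧ all (covered F) X) (all-cong F crossing) (all-cong Y label)
      where
      crossing : ∀ e → not (crosses inL inR e) ≡ not (crosses inL' inR' e)
      crossing (e0 _)       = refl
      crossing (e1 a b _ _) = cong not (cong₂ _∨_ (cong₂ _∧_ (eL a) (eR b)) (cong₂ _∧_ (eR a) (eL b)))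
      label : ∀ y → labelled f F inL inR y ≡ labelled f F inL' inR' y
      label y = cong₂ (λ i r → admits (f y) i r (touches F y false) (touches F y true)) (eL y) (eR y)

    compatible≡compat : ∀ X Y f F L →
      compatible X Y f F L ≡ compat X Y f F (_∈ᵇ L) (λ v → not (v ∈ᵇ L) ∧ v ∈ᵇ (X ++ Y))
    compatible≡compat X Y f F L =
      trans (trans (regroup (simple F) _ (all side Y) _ (all one Y) _)
                   (cong₂ (λ a b → (simple F ∧ a) ∧ b ∧ all (covered F) X)
                          (all-cong F λ { (e0 _) → refl ; (e1 _ _ _ _) → refl }) labels))
            (compat-sides X Y f F (λ _ → refl) (λ v → ∈ᵇ-filterᵇ (λ w → not (w ∈ᵇ L)) v (X ++ Y)))
      where
      inR : Fin n → Bool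
      inR v = v ∈ᵇ filterᵇ (λ w → not (w ∈ᵇ L)) (X ++ Y)
      side none one : Fin n → Bool
      side y = (isL (f y) ⇒ (y ∈ᵇ L)) ∧ (isR (f y) ⇒ inR y)
      none y = is0 (f y) ⇒ not (touches F y false ∨ touches F y true)
      one  y = is1 (f y) ⇒ not (touches F y true)
      labels : all side Y ∧ all (λ y → is0 (f y) ⇒ not (any (λ e → incident e y false ∨ incident e y true) F)) Y
                 ∧ all one Y
             ≡ all (labelled f F (_∈ᵇ L) inR) Y
      labels = begin
          all side Y ∧ all (λ y → is0 (f y) ⇒ not (any (λ e → incident e y false ∨ incident e y true) F)) Y
            ∧ all one Y
        ≡⟨ cong (λ z → all side Y ∧ z ∧ all one Y)
             (all-cong Y (λ y → cong (λ t → is0 (f y) ⇒ not t) (any-∨ _ _ F))) ⟩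
          all side Y ∧ all none Y ∧ all one Y
        ≡⟨ cong (all side Y ∧_) (sym (all-∧ none one Y)) ⟩
          all side Y ∧ all (λ y → none y ∧ one y) Y
        ≡⟨ sym (all-∧ side (λ y → none y ∧ one y) Y) ⟩
          all (labelled f F (_∈ᵇ L) inR) Y
        ∎
        where open ≡-Reasoning

    monomial : List Edge' → Monomial
    monomial F = (ωF F , length F , length (filterᵇ isE1 F))

    coeff-count : ∀ X Y S g (m : Monomial) → coeff (poly (M X Y S g)) m
      ≡ ℤ.+ ∑[ F ∈ subsets S ] ∑[ L ∈ subsets (X ++ Y) ] 𝟙 (compatible X Y g F L ∧ (monomial F ==ᵐ m))
    coeff-count X Y S g m = cong ℤ.+_ (begin
        length (filterᵇ (_==ᵐ m) (map mono (filterᵇ comp pairs)))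
      ≡⟨ length-filterᵇ-map (_==ᵐ m) mono (filterᵇ comp pairs) ⟩
        length (filterᵇ ((_==ᵐ m) ∘ mono) (filterᵇ comp pairs))
      ≡⟨ length-filterᵇ _ (filterᵇ comp pairs) ⟩
        ∑[ x ∈ filterᵇ comp pairs ] 𝟙 (mono x ==ᵐ m)
      ≡⟨ ∑-filterᵇ comp ((_==ᵐ m) ∘ mono) pairs ⟩
        ∑[ x ∈ pairs ] 𝟙 (comp x ∧ (mono x ==ᵐ m))
      ≡⟨ ∑-concatMap (λ F → map (F ,_) (subsets (X ++ Y))) (subsets S) _ ⟩
        ∑[ F ∈ subsets S ] ∑[ x ∈ map (F ,_) (subsets (X ++ Y)) ] 𝟙 (comp x ∧ (mono x ==ᵐ m))
      ≡⟨ ∑-cong (subsets S) (λ F → ∑-map (F ,_) (subsets (X ++ Y)) _) ⟩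
        ∑[ F ∈ subsets S ] ∑[ L ∈ subsets (X ++ Y) ] 𝟙 (compatible X Y g F L ∧ (monomial F ==ᵐ m))
      ∎)
      where
      open ≡-Reasoning
      pairs : List (List Edge' × List (Fin n))
      pairs = concatMap (λ F → map (F ,_) (subsets (X ++ Y))) (subsets S)
      comp : List Edge' × List (Fin n) → Bool
      comp (F , L) = compatible X Y g F L
      mono : List Edge' × List (Fin n) → Monomial
      mono (F , _) = monomial F

    uAdmits : Label → (i t₀ t₁ : Bool) → Bool
    uAdmits l i t₀ t₁ = admits l i (not i) t₀ t₁

    -- At a single candidate pair the five labels of u satisfy an inclusion–exclusion
    -- identity; B is the common part of the conditions, a and b say whether u⁰ and u¹
    -- are touched.  (2_L and 2_R split by the side of u, 1_L plus 1_R is "u¹ untouched",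
    -- 0 is "neither copy touched".)
    local-count : ∀ B i a b →
        𝟙 (B ∧ (a ∧ b)) + (𝟙 (B ∧ uAdmits l1L i a b) + 𝟙 (B ∧ uAdmits l1L i a b))
          + (𝟙 (B ∧ uAdmits l1R i a b) + 𝟙 (B ∧ uAdmits l1R i a b)) + 𝟙 (B ∧ not a)
      ≡ 𝟙 (B ∧ uAdmits l2L i a b) + 𝟙 (B ∧ uAdmits l2R i a b) + 𝟙 (B ∧ uAdmits l0 i a b) + 𝟙 (B ∧ not b)
    local-count false i     a     b     = refl
    local-count true  true  true  true  = refl
    local-count true  true  true  false = refl
    local-count true  true  false true  = refl
    local-count true  true  false false = refl
    local-count true  false true  true  = refl
    local-count true  false true  false = refl
    local-count true  false false true  = refl
    local-count true  false false false = refl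

    module AtVertex (u : Fin n) (f : Fin n → Label) (m : Monomial) where

      -- u is its own ancestor, so u lies in subtree[u] and in tail[u] and can be pulled out
      isAnc-refl : isAnc u u ≡ true
      isAnc-refl = chain-starts parent u

      subtree-extract : subtree[ u ] ↭ u ∷ subtree⟨ u ⟩
      subtree-extract = extract (isAnc u) u isAnc-refl

      tail-extract : tail[ u ] ↭ u ∷ tail⟨ u ⟩
      tail-extract = extract (λ a → isAnc a u) u isAnc-refl

      -- the vertices divided into L and R in P(u,f); those of P[u,·] are the same up to order
      Z : List (Fin n)
      Z = subtree[ u ] ++ tail⟨ u ⟩

      u∈Z : u ∈ᵇ Z ≡ true
      u∈Z = trans (any-↭ (u ==_) (++⁺ʳ tail⟨ u ⟩ subtree-extract))
                  (cong (_∨ (u ∈ᵇ (subtree⟨ u ⟩ ++ tail⟨ u ⟩))) (==-refl u))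

      Z-reorder : subtree⟨ u ⟩ ++ tail[ u ] ↭ Z
      Z-reorder = begin
          subtree⟨ u ⟩ ++ tail[ u ]        ↭⟨ ++⁺ˡ subtree⟨ u ⟩ tail-extract ⟩
          subtree⟨ u ⟩ ++ u ∷ tail⟨ u ⟩    ↭⟨ shift u subtree⟨ u ⟩ tail⟨ u ⟩ ⟩
          u ∷ subtree⟨ u ⟩ ++ tail⟨ u ⟩    ↭⟨ ++⁺ʳ tail⟨ u ⟩ (↭-sym subtree-extract) ⟩
          Z                                ∎
        where open PermutationReasoning

      off-u : ∀ y → isAnc y u ∧ not (y == u) ≡ true → y == u ≡ false
      off-u y = second-false (isAnc y u) (y == u)
        where
        second-false : ∀ a b → a ∧ not b ≡ true → b ≡ false
        second-false true  false _ = refl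
        second-false true  true  ()
        second-false false b     ()

      right : List (Fin n) → Fin n → Bool
      right L v = not (v ∈ᵇ L) ∧ v ∈ᵇ Z

      -- everything P(u,f) and the P[u,f[u ↦ l]] require apart from conditions on u itself
      common : List Edge' → List (Fin n) → Bool
      common F L = compat subtree⟨ u ⟩ tail⟨ u ⟩ f F (_∈ᵇ L) (right L) ∧ (monomial F ==ᵐ m)

      atU : Label → List Edge' → List (Fin n) → Bool
      atU l F L = uAdmits l (u ∈ᵇ L) (touches F u false) (touches F u true)

      P-condition : ∀ F L → compatible subtree[ u ] tail⟨ u ⟩ f F L ∧ (monomial F ==ᵐ m) ≡ common F L ∧ covered F u
      P-condition F L = begin
          compatible subtree[ u ] tail⟨ u ⟩ f F L ∧ μ
        ≡⟨ cong (_∧ μ) (compatible≡compat subtree[ u ] tail⟨ u ⟩ f F L) ⟩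
          (edges ∧ labels ∧ all (covered F) subtree[ u ]) ∧ μ
        ≡⟨ cong (λ c → (edges ∧ labels ∧ c) ∧ μ) (all-↭ (covered F) subtree-extract) ⟩
          (edges ∧ labels ∧ (covered F u ∧ all (covered F) subtree⟨ u ⟩)) ∧ μ
        ≡⟨ pull-out-last edges labels (covered F u) _ μ ⟩
          common F L ∧ covered F u
        ∎
        where
        open ≡-Reasoning
        μ edges labels : Bool
        μ      = monomial F ==ᵐ m
        edges  = simple F ∧ all (not ∘ crosses (_∈ᵇ L) (right L)) F
        labels = all (labelled f F (_∈ᵇ L) (right L)) tail⟨ u ⟩

      -- in P[u,f[u ↦ l]], u ∈ Y carries the label l; R is computed in a reordered vertex list
      B-condition : ∀ l F L → compatible subtree⟨ u ⟩ tail[ u ] (f [ u ↦ l ]) F L ∧ (monomial F ==ᵐ m)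
                              ≡ common F L ∧ atU l F L
      B-condition l F L = begin
          compatible subtree⟨ u ⟩ tail[ u ] g F L ∧ μ
        ≡⟨ cong (_∧ μ) (compatible≡compat subtree⟨ u ⟩ tail[ u ] g F L) ⟩
          compat subtree⟨ u ⟩ tail[ u ] g F (_∈ᵇ L) (λ v → not (v ∈ᵇ L) ∧ v ∈ᵇ (subtree⟨ u ⟩ ++ tail[ u ])) ∧ μ
        ≡⟨ cong (_∧ μ) (compat-sides subtree⟨ u ⟩ tail[ u ] g F (λ _ → refl)
                          (λ v → cong (not (v ∈ᵇ L) ∧_) (any-↭ (v ==_) Z-reorder))) ⟩
          (edges ∧ all (labelled g F (_∈ᵇ L) (right L)) tail[ u ] ∧ covers) ∧ μ
        ≡⟨ cong (λ c → (edges ∧ c ∧ covers) ∧ μ) (all-↭ _ tail-extract) ⟩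
          (edges ∧ (labelled g F (_∈ᵇ L) (right L) u ∧ all (labelled g F (_∈ᵇ L) (right L)) tail⟨ u ⟩) ∧ covers) ∧ μ
        ≡⟨ cong₂ (λ a c → (edges ∧ (a ∧ c) ∧ covers) ∧ μ) at-u away-from-u ⟩
          (edges ∧ (atU l F L ∧ all (labelled f F (_∈ᵇ L) (right L)) tail⟨ u ⟩) ∧ covers) ∧ μ
        ≡⟨ pull-out-middle edges (atU l F L) _ covers μ ⟩
          common F L ∧ atU l F L
        ∎
        where
        open ≡-Reasoning
        g : Fin n → Label
        g = f [ u ↦ l ]
        μ edges covers : Bool
        μ      = monomial F ==ᵐ m
        edges  = simple F ∧ all (not ∘ crosses (_∈ᵇ L) (right L)) F
        covers = all (covered F) subtree⟨ u ⟩
        -- u has label l and lies in R exactly when it is not in L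
        at-u : labelled g F (_∈ᵇ L) (right L) u ≡ atU l F L
        at-u = cong₂ (λ l' r → admits l' (u ∈ᵇ L) r (touches F u false) (touches F u true))
                     (cong (λ b → if b then l else f u) (==-refl u))
                     (trans (cong (not (u ∈ᵇ L) ∧_) u∈Z) (∧-identityʳ _))
        away-from-u : all (labelled g F (_∈ᵇ L) (right L)) tail⟨ u ⟩ ≡ all (labelled f F (_∈ᵇ L) (right L)) tail⟨ u ⟩
        away-from-u = all-filterᵇ-cong (λ a → isAnc a u ∧ not (a == u)) V (λ y e →
          cong (λ l' → admits l' (y ∈ᵇ L) (right L y) (touches F y false) (touches F y true))
               (cong (λ b → if b then l else f y) (off-u y e)))

      common-↭F : ∀ {F F'} L → F ↭ F' → common F L ≡ common F' L
      common-↭F {F} {F'} L p =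
        cong₂ _∧_ (cong₂ _∧_ (cong₂ _∧_ simple-↭ (all-↭ _ p)) (cong₂ _∧_ labels-↭ covers-↭))
                  (cong (_==ᵐ m) monomial-↭)
        where
        simple-↭ : simple F ≡ simple F'
        simple-↭ = trans (all-cong F (λ e → cong (_≤ᵇ 1) (↭-length (filter-↭ (T? ∘ samePi e) p)))) (all-↭ _ p)
        labels-↭ : all (labelled f F (_∈ᵇ L) (right L)) tail⟨ u ⟩ ≡ all (labelled f F' (_∈ᵇ L) (right L)) tail⟨ u ⟩
        labels-↭ = all-cong tail⟨ u ⟩ (λ y → cong₂ (admits (f y) (y ∈ᵇ L) (right L y)) (any-↭ _ p) (any-↭ _ p))
        covers-↭ : all (covered F) subtree⟨ u ⟩ ≡ all (covered F') subtree⟨ u ⟩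
        covers-↭ = all-cong subtree⟨ u ⟩ (λ x → cong₂ _∧_ (any-↭ _ p) (any-↭ _ p))
        monomial-↭ : monomial F ≡ monomial F'
        monomial-↭ = cong₂ _,_ (∑-↭ ω' p) (cong₂ _,_ (↭-length p) (↭-length (filter-↭ (T? ∘ isE1) p)))

      common-↭L : ∀ F {L L'} → L ↭ L' → common F L ≡ common F L'
      common-↭L F p = cong (_∧ _) (compat-sides subtree⟨ u ⟩ tail⟨ u ⟩ f F
        (λ v → any-↭ (v ==_) p) (λ v → cong (λ b → not b ∧ v ∈ᵇ Z) (any-↭ (v ==_) p)))

      atU-↭L : ∀ l F {L L'} → L ↭ L' → atU l F L ≡ atU l F L'
      atU-↭L l F p = cong (λ i → uAdmits l i (touches F u false) (touches F u true)) (any-↭ (u ==_) p)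

      flipU : Edge' → Edge'
      flipU (e0 w)       = e0 w
      flipU (e1 x z s t) = e1 x z ((x == u) xor s) ((z == u) xor t)

      _⇔_ : Bool → Bool → Bool
      a ⇔ b = not (a xor b)

      incident-e1 : ∀ x z a b y s → incident (e1 x z a b) y s ≡ ((x == y) ∧ (a ⇔ s)) ∨ ((z == y) ∧ (b ⇔ s))
      incident-e1 x z true  true  y true  = refl
      incident-e1 x z true  true  y false = refl
      incident-e1 x z true  false y true  = refl
      incident-e1 x z true  false y false = refl
      incident-e1 x z false true  y true  = refl
      incident-e1 x z false true  y false = refl
      incident-e1 x z false false y true  = refl
      incident-e1 x z false false y false = refl

      incident-flip : ∀ e y s → incident (flipU e) y s ≡ incident e y ((y == u) xor s)
      incident-flip (e0 w)       y s = refl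
      incident-flip (e1 x z a b) y s =
        trans (incident-e1 x z _ _ y s) (trans (cong₂ _∨_ (end x a) (end z b)) (sym (incident-e1 x z a b y _)))
        where
        xor-⇔ : ∀ c a s → ((c xor a) ⇔ s) ≡ (a ⇔ (c xor s))
        xor-⇔ false a     s     = refl
        xor-⇔ true  true  true  = refl
        xor-⇔ true  true  false = refl
        xor-⇔ true  false true  = refl
        xor-⇔ true  false false = refl
        end : ∀ w c → (w == y) ∧ (((w == u) xor c) ⇔ s) ≡ (w == y) ∧ (c ⇔ ((y == u) xor s))
        end w c with w == y in w=y
        ... | false = refl
        ... | true with refl ← ==⇒≡ {x = w} {y = y} w=y = xor-⇔ (y == u) c s

      touches-flip : ∀ F y s → touches (map flipU F) y s ≡ touches F y ((y == u) xor s)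
      touches-flip F y s = trans (any-map _ flipU F) (any-cong F (λ e → incident-flip e y s))

      touches-flip-away : ∀ F y s → y == u ≡ false → touches (map flipU F) y s ≡ touches F y s
      touches-flip-away F y s y≠u = trans (touches-flip F y s) (cong (λ c → touches F y (c xor s)) y≠u)

      touches-flip-u : ∀ F → touches (map flipU F) u false ≡ touches F u true
      touches-flip-u F = trans (touches-flip F u false) (cong (λ c → touches F u (c xor false)) (==-refl u))

      covered-flip : ∀ F x → covered (map flipU F) x ≡ covered F x
      covered-flip F x rewrite touches-flip F x false | touches-flip F x true with x == u
      ... | true  = ∧-comm (touches F x true) (touches F x false)
      ... | false = refl

      simple-flip : ∀ F → simple (map flipU F) ≡ simple F
      simple-flip F = trans (all-map _ flipU F) (all-cong F (λ e → cong (_≤ᵇ 1)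
        (trans (length-filterᵇ-map (samePi (flipU e)) flipU F) (cong length (filterᵇ-cong F (samePi-flip e))))))
        where
        samePi-flip : ∀ e e' → samePi (flipU e) (flipU e') ≡ samePi e e'
        samePi-flip (e0 _)       (e0 _)       = refl
        samePi-flip (e0 _)       (e1 _ _ _ _) = refl
        samePi-flip (e1 _ _ _ _) (e0 _)       = refl
        samePi-flip (e1 _ _ _ _) (e1 _ _ _ _) = refl

      monomial-flip : ∀ F → monomial (map flipU F) ≡ monomial F
      monomial-flip F = cong₂ _,_ (trans (∑-map flipU F ω') (∑-cong F ω'-flip))
        (cong₂ _,_ (length-map flipU F)
          (trans (length-filterᵇ-map isE1 flipU F) (cong length (filterᵇ-cong F isE1-flip))))
        where
        ω'-flip : ∀ e → ω' (flipU e) ≡ ω' e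
        ω'-flip (e0 _)       = refl
        ω'-flip (e1 _ _ _ _) = refl
        isE1-flip : ∀ e → isE1 (flipU e) ≡ isE1 e
        isE1-flip (e0 _)       = refl
        isE1-flip (e1 _ _ _ _) = refl

      common-flip : ∀ F L → common (map flipU F) L ≡ common F L
      common-flip F L =
        cong₂ _∧_ (cong₂ _∧_ (cong₂ _∧_ (simple-flip F) crossings) (cong₂ _∧_ labels covers))
                  (cong (_==ᵐ m) (monomial-flip F))
        where
        crossings : all (not ∘ crosses (_∈ᵇ L) (right L)) (map flipU F) ≡ all (not ∘ crosses (_∈ᵇ L) (right L)) F
        crossings = trans (all-map _ flipU F) (all-cong F λ { (e0 _) → refl ; (e1 _ _ _ _) → refl })
        labels : all (labelled f (map flipU F) (_∈ᵇ L) (right L)) tail⟨ u ⟩ ≡ all (labelled f F (_∈ᵇ L) (right L)) tail⟨ u ⟩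
        labels = all-filterᵇ-cong (λ a → isAnc a u ∧ not (a == u)) V (λ y e →
          cong₂ (admits (f y) (y ∈ᵇ L) (right L y))
                (touches-flip-away F y false (off-u y e)) (touches-flip-away F y true (off-u y e)))
        covers : all (covered (map flipU F)) subtree⟨ u ⟩ ≡ all (covered F) subtree⟨ u ⟩
        covers = all-cong subtree⟨ u ⟩ (covered-flip F)

      -- flipU permutes the four copies u^s v^t of each edge of G, hence permutes E' and the sheaf
      copies-flip : ∀ x z c d →
        concatMap (λ s → map (λ t → e1 x z (c xor s) (d xor t)) bools) bools ↭ concatMap (λ s → map (e1 x z s) bools) bools
      copies-flip x z false false = ↭-refl
      copies-flip x z true  false = ++-comm (e1 x z true false ∷ e1 x z true true ∷ []) (e1 x z false false ∷ e1 x z false true ∷ [])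
      copies-flip x z false true  = Perm.swap _ _ (Perm.swap _ _ ↭-refl)
      copies-flip x z true  true  = ↭-trans (++-comm (e1 x z true true ∷ e1 x z true false ∷ []) (e1 x z false true ∷ e1 x z false false ∷ []))
                                            (Perm.swap _ _ (Perm.swap _ _ ↭-refl))

      E'-flip : map flipU E' ↭ E'
      E'-flip = ↭-trans (↭-reflexive (map-++ flipU E'₀ E'₁))
        (++⁺ (↭-reflexive (sym (map-∘ V)))
             (map-concatMap-↭ flipU _ V (λ x → map-concatMap-↭ flipU _ V (λ z → block x z (does (x <? z) ∧ Adj x z)))))
        where
        block : ∀ x z b → map flipU (if b then concatMap (λ s → map (e1 x z s) bools) bools else [])
                          ↭ (if b then concatMap (λ s → map (e1 x z s) bools) bools else [])
        block x z true  = copies-flip x z (x == u) (z == u)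
        block x z false = ↭-refl

      sheaf-flip : map flipU (sheaf u) ↭ sheaf u
      sheaf-flip = ↭-trans (↭-reflexive (map-filterᵇ flipU (λ e → isAnc u (leftBar e)) leftBar-flip E'))
                           (filter-↭ (T? ∘ (λ e → isAnc u (leftBar e))) E'-flip)
        where
        leftBar-flip : ∀ e → isAnc u (leftBar (flipU e)) ≡ isAnc u (leftBar e)
        leftBar-flip (e0 _)       = refl
        leftBar-flip (e1 _ _ _ _) = refl

      Weight : Set
      Weight = List Edge' → List (Fin n) → ℕ

      _⊕_ : Weight → Weight → Weight
      (w ⊕ w') F L = w F L + w' F L
      infixl 6 _⊕_

      total : Weight → ℕ
      total w = ∑[ F ∈ subsets (sheaf u) ] ∑[ L ∈ subsets Z ] w F L

      total-⊕ : ∀ w w' → total (w ⊕ w') ≡ total w + total w'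
      total-⊕ w w' = trans (∑-cong (subsets (sheaf u)) (λ F → ∑-+ (subsets Z) (w F) (w' F)))
                           (∑-+ (subsets (sheaf u)) _ _)

      total-cong : ∀ {w w' : Weight} → (∀ F L → w F L ≡ w' F L) → total w ≡ total w'
      total-cong e = ∑-cong (subsets (sheaf u)) (λ F → ∑-cong (subsets Z) (e F))

      wP : Weight
      wP F L = 𝟙 (common F L ∧ covered F u)

      wB : Label → Weight
      wB l F L = 𝟙 (common F L ∧ atU l F L)

      w-no : Bool → Weight
      w-no s F L = 𝟙 (common F L ∧ not (touches F u s))

      -- the two kinds of coefficient as totals; for P[u,·] the sets L are first moved from
      -- subtree(u) ∪ tail[u] to the reordered list Z
      coeff-P : coeff P⟨ u , f ⟩ m ≡ ℤ.+ total wP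
      coeff-P = trans (coeff-count subtree[ u ] tail⟨ u ⟩ (sheaf u) f m)
                      (cong ℤ.+_ (total-cong (λ F L → cong 𝟙 (P-condition F L))))

      coeff-B : ∀ l → coeff P[ u , f [ u ↦ l ] ] m ≡ ℤ.+ total (wB l)
      coeff-B l = trans (coeff-count subtree⟨ u ⟩ tail[ u ] (sheaf u) (f [ u ↦ l ]) m)
        (cong ℤ.+_ (∑-cong (subsets (sheaf u)) (λ F →
          trans (∑-cong (subsets (subtree⟨ u ⟩ ++ tail[ u ])) (λ L → cong 𝟙 (B-condition l F L)))
                (∑-subsets-↭ Z-reorder (wB l F) (λ p → cong 𝟙 (cong₂ _∧_ (common-↭L F p) (atU-↭L l F p)))))))

      -- flipping u⁰ and u¹ matches the pairs missing u⁰ with those missing u¹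
      missing-symmetry : total (w-no false) ≡ total (w-no true)
      missing-symmetry = begin
          ∑[ F ∈ subsets (sheaf u) ] W F
        ≡⟨ ∑-subsets-↭ (↭-sym sheaf-flip) W W-↭ ⟩
          sumOver (subsets (map flipU (sheaf u))) W
        ≡⟨ cong (λ s → sumOver s W) (subsets-map flipU (sheaf u)) ⟩
          sumOver (map (map flipU) (subsets (sheaf u))) W
        ≡⟨ ∑-map (map flipU) (subsets (sheaf u)) W ⟩
          ∑[ F ∈ subsets (sheaf u) ] W (map flipU F)
        ≡⟨ total-cong (λ F L → cong 𝟙 (cong₂ _∧_ (common-flip F L) (cong not (touches-flip-u F)))) ⟩
          total (w-no true)
        ∎
        where
        open ≡-Reasoning
        W : List Edge' → ℕ
        W F = ∑[ L ∈ subsets Z ] w-no false F L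
        W-↭ : Respects↭ W
        W-↭ p = ∑-cong (subsets Z) (λ L → cong 𝟙 (cong₂ _∧_ (common-↭F L p) (cong not (any-↭ _ p))))

      -- summing local-count over all candidate pairs, and cancelling the two missing-copy terms
      main-count : total wP + (total (wB l1L) + total (wB l1L)) + (total (wB l1R) + total (wB l1R))
                 ≡ total (wB l2L) + total (wB l2R) + total (wB l0)
      main-count = +-cancelʳ-≡ (total (w-no true)) _ _ (begin
          total wP + (total (wB l1L) + total (wB l1L)) + (total (wB l1R) + total (wB l1R)) + total (w-no true)
        ≡⟨ cong (P-side +_) (sym missing-symmetry) ⟩
          total wP + (total (wB l1L) + total (wB l1L)) + (total (wB l1R) + total (wB l1R)) + total (w-no false)
        ≡⟨ sym (trans (total-⊕ _ _) (cong (_+ total (w-no false)) (trans (total-⊕ _ _) (cong₂ _+_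
                 (trans (total-⊕ _ _) (cong (total wP +_) (total-⊕ _ _))) (total-⊕ _ _))))) ⟩
          total (wP ⊕ (wB l1L ⊕ wB l1L) ⊕ (wB l1R ⊕ wB l1R) ⊕ w-no false)
        ≡⟨ total-cong (λ F L → local-count (common F L) (u ∈ᵇ L) (touches F u false) (touches F u true)) ⟩
          total (wB l2L ⊕ wB l2R ⊕ wB l0 ⊕ w-no true)
        ≡⟨ trans (total-⊕ _ _) (cong (_+ total (w-no true)) (trans (total-⊕ _ _) (cong (_+ total (wB l0)) (total-⊕ _ _)))) ⟩
          total (wB l2L) + total (wB l2R) + total (wB l0) + total (w-no true)
        ∎)
        where
        open ≡-Reasoning
        P-side : ℕ
        P-side = total wP + (total (wB l1L) + total (wB l1L)) + (total (wB l1R) + total (wB l1R))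

open import Data.Nat using (ℕ)
open import Data.Fin using (Fin)
open import Data.Integer using (ℤ; _+_; _-_; _*_; +_)
open import Data.Integer.Tactic.RingSolver using (solve-∀)
open import Relation.Binary.PropositionalEquality using (_≡_; sym; trans; cong; cong₂; module ≡-Reasoning)
open Proof using (module Decomposition)

recurrence : (Label → ℤ) → ℤ
recurrence c = c l2L + c l2R - + 2 * c l1L - + 2 * c l1R + c l0

recurrence-cong : {c c' : Label → ℤ} → (∀ l → c l ≡ c' l) → recurrence c ≡ recurrence c'
recurrence-cong e =
  cong₂ _+_ (cong₂ _-_ (cong₂ _-_ (cong₂ _+_ (e l2L) (e l2R)) (cong (+ 2 *_) (e l1L))) (cong (+ 2 *_) (e l1R))) (e l0)

isolate : (p : ℤ) (c : Label → ℤ) →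
  p + (c l1L + c l1L) + (c l1R + c l1R) ≡ c l2L + c l2R + c l0 → p ≡ recurrence c
isolate p c e = trans (add-and-subtract p (c l1L) (c l1R))
  (trans (cong (λ t → t - (c l1L + c l1L) - (c l1R + c l1R)) e) (regroup (c l2L) (c l2R) (c l1L) (c l1R) (c l0)))
  where
  add-and-subtract : ∀ (p a b : ℤ) → p ≡ p + (a + a) + (b + b) - (a + a) - (b + b)
  add-and-subtract = solve-∀
  regroup : ∀ (a b c d e : ℤ) → a + b + e - (c + c) - (d + d) ≡ a + b - + 2 * c - + 2 * d + e
  regroup = solve-∀

lemma7 : {n : ℕ} (G : Setting n) → let open Construction G in
    (u : Fin n) (f : Fin n → Label) (m : Monomial) →
    coeff P⟨ u , f ⟩ m ≡
      coeff P[ u , f [ u ↦ l2L ] ] m + coeff P[ u , f [ u ↦ l2R ] ] m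
      - + 2 * coeff P[ u , f [ u ↦ l1L ] ] m - + 2 * coeff P[ u , f [ u ↦ l1R ] ] m
      + coeff P[ u , f [ u ↦ l0 ] ] m
lemma7 G u f m = begin
    coeff P⟨ u , f ⟩ m                               ≡⟨ coeff-P ⟩
    + total wP                                       ≡⟨ isolate _ (λ l → + total (wB l)) (cong +_ main-count) ⟩
    recurrence (λ l → + total (wB l))                ≡⟨ recurrence-cong (λ l → sym (coeff-B l)) ⟩
    recurrence (λ l → coeff P[ u , f [ u ↦ l ] ] m)  ∎
  where
  open ≡-Reasoning
  open Construction G
  open Decomposition.AtVertex G u f m
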